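{- Let $a,b,c,d$ be positive integers satisfying $b+1\ge a$ and $c+1\ge d$. If $a>5$ and $d>5$, then $$abc+abd+acd+bcd+ab+ac+ad+bc+bd+cd+a+b+c+d+1 < abcd,$$ i.e. the inequality $abc+abd+acd+bcd+ab+ac+ad+bc+bd+cd+a+b+c+d+1\ge abcd$ is not satisfied.
   Context: These inequalities are necessary conditions for $(a,b,c,d)$ to be the first diagonal of an arithmetic Y-frieze pattern of width $4$. -}

module Defs where

-- The left-hand side plus abcd is (a+1)(b+1)(c+1)(d+1), so the claim is
-- (1 + 1/a)(1 + 1/b)(1 + 1/c)(1 + 1/d) < 2.  The hypotheses give a, d ≥ 6
-- and b, c ≥ 5, hence the product is at most (7/6)²(6/5)² = 49/25 < 2.
module Submission where

open import Defs
open import Data.Nat using (ℕ; suc; _+_; _*_; _≤_; _<_; _>_; s≤s; z≤n; z<s; >-nonZero)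
open import Data.Nat.Properties
open import Data.Nat.Tactic.RingSolver using (solve-∀)
open import Relation.Binary.PropositionalEquality using (_≡_; sym; subst)

suc-product-expansion : ∀ a b c d →
  a * b * c + a * b * d + a * c * d + b * c * d
    + a * b + a * c + a * d + b * c + b * d + c * d
    + a + b + c + d + 1 + a * b * c * d
  ≡ suc a * suc b * suc c * suc d
suc-product-expansion = solve-∀

suc*≤*suc : ∀ {k x} → k ≤ x → suc x * k ≤ x * suc k
suc*≤*suc {k} {x} k≤x = begin
  suc x * k   ≡⟨⟩
  k + x * k   ≤⟨ +-monoˡ-≤ (x * k) k≤x ⟩
  x + x * k   ≡⟨ *-suc x k ⟨
  x * suc k   ∎
  where open ≤-Reasoning

suc-product<double-product : ∀ {a b c d} → 6 ≤ a → 5 ≤ b → 5 ≤ c → 6 ≤ d →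
  suc a * suc b * suc c * suc d < a * b * c * d + a * b * c * d
suc-product<double-product {a} {b} {c} {d} 6≤a 5≤b 5≤c 6≤d =
  *-cancelˡ-< 900 _ _ (begin-strict
    900 * (suc a * suc b * suc c * suc d)
      ≡⟨ scale-left a b c d ⟩
    suc a * 6 * (suc b * 5) * (suc c * 5) * (suc d * 6)
      ≤⟨ *-mono-≤ (*-mono-≤ (*-mono-≤ (suc*≤*suc 6≤a) (suc*≤*suc 5≤b))
                             (suc*≤*suc 5≤c)) (suc*≤*suc 6≤d) ⟩
    a * 7 * (b * 6) * (c * 6) * (d * 7)
      ≡⟨ scale-right a b c d ⟩
    1764 * p
      <⟨ *-monoˡ-< p {{>-nonZero p>0}} (m<m+n 1764 {36} z<s) ⟩
    1800 * p
      ≡⟨ scale-double p ⟩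
    900 * (p + p) ∎)
  where
  open ≤-Reasoning
  p : ℕ
  p = a * b * c * d
  p>0 : p > 0
  p>0 = *-mono-≤ (*-mono-≤ (*-mono-≤ (≤-trans (s≤s z≤n) 6≤a) (≤-trans (s≤s z≤n) 5≤b))
                           (≤-trans (s≤s z≤n) 5≤c)) (≤-trans (s≤s z≤n) 6≤d)
  scale-left : ∀ a b c d → 900 * (suc a * suc b * suc c * suc d)
    ≡ suc a * 6 * (suc b * 5) * (suc c * 5) * (suc d * 6)
  scale-left = solve-∀
  scale-right : ∀ a b c d → a * 7 * (b * 6) * (c * 6) * (d * 7) ≡ 1764 * (a * b * c * d)
  scale-right = solve-∀
  scale-double : ∀ p → 1800 * p ≡ 900 * (p + p)
  scale-double = solve-∀

proposition3p1 : (a b c d : ℕ) → 1 ≤ a → 1 ≤ b → 1 ≤ c → 1 ≤ d →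
    a ≤ b + 1 → d ≤ c + 1 → a > 5 → d > 5 →
    a * b * c + a * b * d + a * c * d + b * c * d
      + a * b + a * c + a * d + b * c + b * d + c * d
      + a + b + c + d + 1 < a * b * c * d
proposition3p1 a b c d _ _ _ _ a≤b+1 d≤c+1 a>5 d>5 =
  +-cancelʳ-< (a * b * c * d) _ _
    (subst (_< a * b * c * d + a * b * c * d) (sym (suc-product-expansion a b c d))
      (suc-product<double-product a>5 5≤b 5≤c d>5))
  where
  5≤b : 5 ≤ b
  5≤b = +-cancelʳ-≤ 1 5 b (≤-trans a>5 a≤b+1)
  5≤c : 5 ≤ c
  5≤c = +-cancelʳ-≤ 1 5 c (≤-trans d>5 d≤c+1)
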